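{- Let $G_1$ and $G_2$ be finite graphs and let $H$ be a tight product of $G_1$ and $G_2$. Then: (1) every eigenvalue of (the adjacency matrix of) $G_1$ or of $G_2$ is also an eigenvalue of $H$; (2) if $G_1$ or $G_2$ is bipartite, then $H$ is bipartite; (3) if $G_1$ or $G_2$ is disconnected, then $H$ is disconnected; (4) if both $G_1$ and $G_2$ are bipartite, then $H$ is disconnected; (5) $G_1$ and $G_2$ are both $d$-regular for the same $d$.
   Context: All graphs are finite, undirected, and may have multiple edges and loops. Degrees count multiple edges with multiplicity, and a loop contributes $2$ to the degree of its vertex; the neighbor set $N_G(v)$ is a multiset. A map $\phi:V(H)\to V(G)$ is a covering map if for every $v\in V(H)$, $\phi$ maps the multiset $N_H(v)$ one-to-one and onto the multiset $N_G(\phi(v))$. A graph $H$ is a tight product of graphs $G_1$ and $G_2$ if $V(H)=V(G_1)\times V(G_2)$ and both coordinate projections $V(H)\to V(G_1)$ and $V(H)\to V(G_2)$ are covering maps. -}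

module Defs where

open import Level using (_⊔_)
open import Data.Nat using (ℕ; zero; suc; _+_)
open import Data.Fin using (Fin)
import Data.Fin.Properties as FinP
open import Data.Bool using (Bool; if_then_else_)
open import Data.List using (List; map; allFin; cartesianProduct; foldr)
open import Data.Nat.ListAction using (sum)
open import Data.Product using (_×_; _,_; proj₁; proj₂; ∃; Σ)
open import Data.Product.Properties using (≡-dec)
open import Relation.Binary.PropositionalEquality using (_≡_; _≢_)
open import Relation.Binary.Definitions using (DecidableEquality)
open import Relation.Nullary using (¬_; does)
open import Algebra.Bundles using (CommutativeRing)

-- A finite vertex type, given by a concrete list of all its elements
-- (each exactly once) together with decidable equality.
record Enumerated (V : Set) : Set where
  field
    elems : List V
    _≟V_  : DecidableEquality V

open Enumerated {{...}} public

instance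
  finEnum : ∀ {n} → Enumerated (Fin n)
  finEnum {n} = record { elems = allFin n ; _≟V_ = FinP._≟_ }

  pairEnum : ∀ {m n} → Enumerated (Fin m × Fin n)
  pairEnum {m} {n} = record
    { elems = cartesianProduct (allFin m) (allFin n)
    ; _≟V_  = ≡-dec FinP._≟_ FinP._≟_ }

∑ℕ : ∀ {V : Set} {{_ : Enumerated V}} → (V → ℕ) → ℕ
∑ℕ f = sum (map f elems)

-- A finite multigraph with loops on vertex set V, given by its adjacency
-- matrix: adj u v = multiplicity of v in the multiset N(u).
-- A loop at v contributes v twice to N(v), so adj v v is even.
record Graph (V : Set) : Set where
  field
    adj        : V → V → ℕ
    adj-sym    : ∀ u v → adj u v ≡ adj v u
    loops-even : ∀ v → ∃ λ k → adj v v ≡ k + k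

open Graph public

degree : ∀ {V : Set} {{_ : Enumerated V}} → Graph V → V → ℕ
degree G v = ∑ℕ (adj G v)

-- φ : V(H) → V(G) is a covering map: for every v, φ maps the multiset N_H(v)
-- bijectively onto N_G(φ v), i.e. for every w the number of neighbours
-- (with multiplicity) of v lying over w equals the multiplicity of w in N_G(φ v).
IsCovering : ∀ {V W : Set} {{_ : Enumerated V}} {{_ : Enumerated W}} →
             Graph V → Graph W → (V → W) → Set
IsCovering H G φ =
  ∀ v w → ∑ℕ (λ u → if does (φ u ≟V w) then adj H v u else 0) ≡ adj G (φ v) w

IsTightProduct : ∀ {n₁ n₂} → Graph (Fin n₁) → Graph (Fin n₂) →
                 Graph (Fin n₁ × Fin n₂) → Set
IsTightProduct G₁ G₂ H = IsCovering H G₁ proj₁ × IsCovering H G₂ proj₂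

module _ {c ℓ} (R : CommutativeRing c ℓ) where
  open CommutativeRing R using (Carrier; 0#; 1#; _≈_) renaming (_+_ to _+R_; _*_ to _*R_)

  ℕ→R : ℕ → Carrier
  ℕ→R zero    = 0#
  ℕ→R (suc n) = 1# +R ℕ→R n

  ∑R : ∀ {V : Set} {{_ : Enumerated V}} → (V → Carrier) → Carrier
  ∑R f = foldr (λ x acc → f x +R acc) 0# elems

  IsEigenvalue : ∀ {V : Set} {{_ : Enumerated V}} → Graph V → Carrier → Set (c ⊔ ℓ)
  IsEigenvalue {V} G μ =
    Σ (V → Carrier) λ x →
      (¬ (∀ v → x v ≈ 0#)) ×
      (∀ u → ∑R (λ v → ℕ→R (adj G u v) *R x v) ≈ μ *R x u)

Bipartite : ∀ {V : Set} → Graph V → Set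
Bipartite {V} G = Σ (V → Bool) λ col → ∀ u v → adj G u v ≢ 0 → col u ≢ col v

data Reach {V : Set} (G : Graph V) : V → V → Set where
  here : ∀ {v} → Reach G v v
  step : ∀ {u w v} → adj G u w ≢ 0 → Reach G w v → Reach G u v

Connected : ∀ {V : Set} → Graph V → Set
Connected G = ∀ u v → Reach G u v

Disconnected : ∀ {V : Set} → Graph V → Set
Disconnected G = ¬ Connected G

Regular : ∀ {V : Set} {{_ : Enumerated V}} → Graph V → ℕ → Set
Regular G d = ∀ v → degree G v ≡ d

-- A covering map φ : H → G preserves degrees and sends edges to edges, so
-- walks of H project to walks of G and proper 2-colourings of G pull back
-- along φ; eigenvectors pull back as well, since A_H (x ∘ φ) = (A_G x) ∘ φ.
-- When φ is onto, a pulled-back eigenvector stays nonzero and disconnection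
-- of G lifts to H. The coordinate projections of a tight product are onto
-- coverings, giving (1)–(3), and (5) because deg G₁ a = deg H (a , b) = deg G₂ b.
-- For (4), 2-colourings c₁, c₂ of the factors make c₁ x xor c₂ y invariant
-- along edges of H, while (a , y) and (b , y) get opposite values whenever
-- a b is an edge of G₁; such an edge exists as soon as H is connected with at
-- least two vertices.
module Submission where

open import Defs
open import Data.Nat using (ℕ; _≤_; _*_)
open import Data.Fin using (Fin)
open import Data.Product using (_×_; ∃)
open import Data.Sum using (_⊎_)
open import Algebra.Bundles using (CommutativeRing)

open import Data.Nat as ℕ using (zero; suc; s≤s)
import Data.Nat.Properties as ℕₚ
open import Data.Fin as Fin using (fromℕ<)
import Data.Fin.Properties as Fin
open import Data.Bool using (Bool; false; true; not; _xor_; if_then_else_)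
open import Data.Bool.Properties using (¬-not; not-¬; not-involutive; not-distribˡ-xor)
open import Data.List using (List; []; _∷_; foldr; allFin; tabulate)
open import Data.List.Properties using (foldr-map)
open import Data.List.Membership.Propositional using (_∈_)
open import Data.List.Membership.Propositional.Properties using (∈-cartesianProduct⁺; ∈-allFin)
open import Data.List.Relation.Unary.Any using (here; there)
open import Data.Product using (_,_; proj₁; proj₂; ∃₂)
open import Data.Sum using ([_,_])
open import Relation.Nullary using (¬_; does; yes; no)
open import Relation.Nullary.Decidable using (dec-true)
open import Relation.Binary.PropositionalEquality
  using (_≡_; _≢_; refl; sym; trans; cong; cong₂; subst; subst₂; module ≡-Reasoning)
open import Algebra.Bundles using (CommutativeMonoid)
import Algebra.Properties.CommutativeSemigroup as CommutativeSemigroupProperties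
open import Function using (_∘_)
open import Function.Definitions using (StrictlySurjective)

module ListSum {c ℓ} (M : CommutativeMonoid c ℓ) where
  open CommutativeMonoid M renaming (refl to ≈-refl; sym to ≈-sym; trans to ≈-trans)
  open import Relation.Binary.Reasoning.Setoid setoid
  open CommutativeSemigroupProperties commutativeSemigroup using (interchange)

  ∑ : ∀ {U : Set} → List U → (U → Carrier) → Carrier
  ∑ L f = foldr (λ x acc → f x ∙ acc) ε L

  ∑-cong : ∀ {U : Set} (L : List U) {f g : U → Carrier} → (∀ x → f x ≈ g x) → ∑ L f ≈ ∑ L g
  ∑-cong []      f≈g = ≈-refl
  ∑-cong (x ∷ L) f≈g = ∙-cong (f≈g x) (∑-cong L f≈g)

  ∑-zero : ∀ {U : Set} (L : List U) → ∑ L (λ _ → ε) ≈ ε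
  ∑-zero []      = ≈-refl
  ∑-zero (x ∷ L) = ≈-trans (identityˡ _) (∑-zero L)

  ∑-distrib : ∀ {U : Set} (L : List U) (f g : U → Carrier) → ∑ L (λ x → f x ∙ g x) ≈ ∑ L f ∙ ∑ L g
  ∑-distrib []      f g = ≈-sym (identityˡ ε)
  ∑-distrib (x ∷ L) f g = ≈-trans (∙-congˡ (∑-distrib L f g)) (interchange _ _ _ _)

  ∑-comm : ∀ {U W : Set} (L : List U) (K : List W) (h : U → W → Carrier) →
           ∑ L (λ u → ∑ K (h u)) ≈ ∑ K (λ w → ∑ L (λ u → h u w))
  ∑-comm []      K h = ≈-sym (∑-zero K)
  ∑-comm (u ∷ L) K h = ≈-trans (∙-congˡ (∑-comm L K h)) (≈-sym (∑-distrib K (h u) _))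

  ∑-tabulate : ∀ {k} n (t : Fin n → Fin k) (f : Fin k → Carrier) → ∑ (tabulate t) f ≡ ∑ (allFin n) (f ∘ t)
  ∑-tabulate zero    t f = refl
  ∑-tabulate (suc n) t f = cong (f (t Fin.zero) ∙_)
    (trans (∑-tabulate n (t ∘ Fin.suc) f) (sym (∑-tabulate n Fin.suc (f ∘ t))))

  ∑-indicator : ∀ n (a : Fin n) (f : Fin n → Carrier) →
                ∑ (allFin n) (λ w → if does (a Fin.≟ w) then f w else ε) ≈ f a
  ∑-indicator (suc n) Fin.zero f = begin
    f Fin.zero ∙ ∑ (tabulate Fin.suc) (λ w → if does (Fin.zero Fin.≟ w) then f w else ε)
      ≡⟨ cong (f Fin.zero ∙_) (∑-tabulate n Fin.suc _) ⟩
    f Fin.zero ∙ ∑ (allFin n) (λ _ → ε)  ≈⟨ ∙-congˡ (∑-zero (allFin n)) ⟩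
    f Fin.zero ∙ ε                        ≈⟨ identityʳ _ ⟩
    f Fin.zero                            ∎
  ∑-indicator (suc n) (Fin.suc a) f = begin
    ε ∙ ∑ (tabulate Fin.suc) (λ w → if does (Fin.suc a Fin.≟ w) then f w else ε)
      ≈⟨ identityˡ _ ⟩
    ∑ (tabulate Fin.suc) (λ w → if does (Fin.suc a Fin.≟ w) then f w else ε)
      ≡⟨ ∑-tabulate n Fin.suc _ ⟩
    ∑ (allFin n) (λ w → if does (a Fin.≟ w) then f (Fin.suc w) else ε)
      ≈⟨ ∑-indicator n a (f ∘ Fin.suc) ⟩
    f (Fin.suc a) ∎

  ∑-fibres : ∀ {U : Set} {m} (L : List U) (φ : U → Fin m) (f : U → Carrier) →
             ∑ (allFin m) (λ w → ∑ L (λ u → if does (φ u Fin.≟ w) then f u else ε)) ≈ ∑ L f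
  ∑-fibres {m = m} L φ f = ≈-trans (∑-comm (allFin m) L _)
    (∑-cong L (λ u → ∑-indicator m (φ u) (λ _ → f u)))

module ℕΣ = ListSum ℕₚ.+-0-commutativeMonoid

∑ℕ≡∑ : ∀ {U : Set} {{_ : Enumerated U}} (f : U → ℕ) → ∑ℕ f ≡ ℕΣ.∑ elems f
∑ℕ≡∑ f = foldr-map ℕ._+_ f 0 elems

∑≡0⇒≡0 : ∀ {U : Set} {L : List U} (f : U → ℕ) {x} → x ∈ L → ℕΣ.∑ L f ≡ 0 → f x ≡ 0
∑≡0⇒≡0 {L = y ∷ L} f (here refl) ∑≡0 = ℕₚ.m+n≡0⇒m≡0 (f y) ∑≡0
∑≡0⇒≡0 {L = y ∷ L} f (there x∈L) ∑≡0 = ∑≡0⇒≡0 f x∈L (ℕₚ.m+n≡0⇒n≡0 (f y) ∑≡0)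

module RingSum {c ℓ} (R : CommutativeRing c ℓ) where
  open CommutativeRing R
    renaming (_+_ to _+R_; _*_ to _*R_; refl to ≈-refl; sym to ≈-sym; trans to ≈-trans)
  open ListSum +-commutativeMonoid public

  ℕ→R-+ : ∀ a b → ℕ→R R (a ℕ.+ b) ≈ ℕ→R R a +R ℕ→R R b
  ℕ→R-+ zero    b = ≈-sym (+-identityˡ _)
  ℕ→R-+ (suc a) b = ≈-trans (+-congˡ (ℕ→R-+ a b)) (≈-sym (+-assoc _ _ _))

  ℕ→R-∑ : ∀ {U : Set} (L : List U) (f : U → ℕ) → ℕ→R R (ℕΣ.∑ L f) ≈ ∑ L (ℕ→R R ∘ f)
  ℕ→R-∑ []      f = ≈-refl
  ℕ→R-∑ (x ∷ L) f = ≈-trans (ℕ→R-+ (f x) _) (+-congˡ (ℕ→R-∑ L f))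

  ∑-distribʳ : ∀ {U : Set} (L : List U) (f : U → Carrier) k → ∑ L f *R k ≈ ∑ L (λ x → f x *R k)
  ∑-distribʳ []      f k = zeroˡ k
  ∑-distribʳ (x ∷ L) f k = ≈-trans (distribʳ k _ _) (+-congˡ (∑-distribʳ L f k))

module Covering {V : Set} {{_ : Enumerated V}} {m} {H : Graph V} {G : Graph (Fin m)}
                {φ : V → Fin m} (covering : IsCovering H G φ) where

  private
    vertices : List V
    vertices = elems

  fibre-multiplicity : ∀ v w → ℕΣ.∑ vertices (λ u → if does (φ u Fin.≟ w) then adj H v u else 0) ≡ adj G (φ v) w
  fibre-multiplicity v w = trans (sym (∑ℕ≡∑ {V} _)) (covering v w)

  degree-preserved : ∀ v → degree H v ≡ degree G (φ v)
  degree-preserved v = begin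
    degree H v                     ≡⟨ ∑ℕ≡∑ (adj H v) ⟩
    ℕΣ.∑ vertices (adj H v)        ≡⟨ sym (ℕΣ.∑-fibres vertices φ (adj H v)) ⟩
    ℕΣ.∑ (allFin m) (λ w → ℕΣ.∑ vertices (λ u → if does (φ u Fin.≟ w) then adj H v u else 0))
                                   ≡⟨ ℕΣ.∑-cong (allFin m) (fibre-multiplicity v) ⟩
    ℕΣ.∑ (allFin m) (adj G (φ v))  ≡⟨ sym (∑ℕ≡∑ (adj G (φ v))) ⟩
    degree G (φ v)                 ∎
    where open ≡-Reasoning

  module _ (vertices-complete : ∀ v → v ∈ vertices) where

    edge-image : ∀ u v → adj H u v ≢ 0 → adj G (φ u) (φ v) ≢ 0
    edge-image u v uv≢0 φuφv≡0 = uv≢0 (begin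
      adj H u v
        ≡⟨ cong (λ b → if b then adj H u v else 0) (sym (dec-true (φ v Fin.≟ φ v) refl)) ⟩
      (if does (φ v Fin.≟ φ v) then adj H u v else 0)
        ≡⟨ ∑≡0⇒≡0 _ (vertices-complete v) (trans (fibre-multiplicity u (φ v)) φuφv≡0) ⟩
      0 ∎)
      where open ≡-Reasoning

    Reach-image : ∀ {u v} → Reach H u v → Reach G (φ u) (φ v)
    Reach-image here       = here
    Reach-image (step e r) = step (edge-image _ _ e) (Reach-image r)

    bipartite-pullback : Bipartite G → Bipartite H
    bipartite-pullback (colour , proper) = colour ∘ φ , λ u v e → proper (φ u) (φ v) (edge-image u v e)

    disconnected-pullback : StrictlySurjective _≡_ φ → Disconnected G → Disconnected H
    disconnected-pullback surjective disconnected connected = disconnected λ a b →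
      let (u , φu≡a) = surjective a ; (v , φv≡b) = surjective b
      in subst₂ (Reach G) φu≡a φv≡b (Reach-image (connected u v))

  module _ {c ℓ} (R : CommutativeRing c ℓ) where
    open CommutativeRing R
      renaming (Carrier to K; _+_ to _+R_; _*_ to _*R_; refl to ≈-refl; sym to ≈-sym; trans to ≈-trans)
    open RingSum R
    open import Relation.Binary.Reasoning.Setoid setoid

    private
      ι : ℕ → K
      ι = ℕ→R R

      restrict-to-fibre : ∀ (x : Fin m → K) a v w →
        ι (if does (φ v Fin.≟ w) then a else 0) *R x w ≈ (if does (φ v Fin.≟ w) then ι a *R x (φ v) else 0#)
      restrict-to-fibre x a v w with φ v Fin.≟ w
      ... | yes refl = ≈-refl
      ... | no  _    = zeroˡ _

    adjacency-pullback : ∀ (x : Fin m → K) u →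
      ∑R R (λ v → ι (adj H u v) *R x (φ v)) ≈ ∑R R (λ w → ι (adj G (φ u) w) *R x w)
    adjacency-pullback x u = begin
      ∑ vertices (λ v → ι (adj H u v) *R x (φ v))
        ≈⟨ ∑-fibres vertices φ _ ⟨
      ∑ (allFin m) (λ w → ∑ vertices (λ v → if does (φ v Fin.≟ w) then ι (adj H u v) *R x (φ v) else 0#))
        ≈⟨ ∑-cong (allFin m) (λ w → ∑-cong vertices (λ v → restrict-to-fibre x (adj H u v) v w)) ⟨
      ∑ (allFin m) (λ w → ∑ vertices (λ v → ι (if does (φ v Fin.≟ w) then adj H u v else 0) *R x w))
        ≈⟨ ∑-cong (allFin m) (λ w → ∑-distribʳ vertices _ (x w)) ⟨
      ∑ (allFin m) (λ w → ∑ vertices (λ v → ι (if does (φ v Fin.≟ w) then adj H u v else 0)) *R x w)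
        ≈⟨ ∑-cong (allFin m) (λ w → *-congʳ (ℕ→R-∑ vertices _)) ⟨
      ∑ (allFin m) (λ w → ι (ℕΣ.∑ vertices (λ v → if does (φ v Fin.≟ w) then adj H u v else 0)) *R x w)
        ≈⟨ ∑-cong (allFin m) (λ w → reflexive (cong (λ n → ι n *R x w) (fibre-multiplicity u w))) ⟩
      ∑ (allFin m) (λ w → ι (adj G (φ u) w) *R x w) ∎

    eigenvalue-pullback : StrictlySurjective _≡_ φ → ∀ {μ} → IsEigenvalue R G μ → IsEigenvalue R H μ
    eigenvalue-pullback surjective (x , x≉0 , eigen) =
      x ∘ φ , x∘φ≉0 , λ u → ≈-trans (adjacency-pullback x u) (eigen (φ u))
      where
      x∘φ≉0 : ¬ (∀ v → x (φ v) ≈ 0#)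
      x∘φ≉0 x∘φ≈0 = x≉0 λ w →
        let (v , φv≡w) = surjective w in subst (λ w → x w ≈ 0#) φv≡w (x∘φ≈0 v)

pairs-complete : ∀ {n₁ n₂} (v : Fin n₁ × Fin n₂) → v ∈ elems
pairs-complete (a , b) = ∈-cartesianProduct⁺ (∈-allFin a) (∈-allFin b)

two-distinct-pairs : ∀ {n₁ n₂} → 2 ≤ n₁ * n₂ → ∃₂ λ (u v : Fin n₁ × Fin n₂) → u ≢ v
two-distinct-pairs {suc (suc _)} {suc _} _ = (Fin.zero , Fin.zero) , (Fin.suc Fin.zero , Fin.zero) , λ ()
two-distinct-pairs {suc zero} {suc (suc _)} _ = (Fin.zero , Fin.zero) , (Fin.zero , Fin.suc Fin.zero) , λ ()
two-distinct-pairs {suc zero} {suc zero} (s≤s ())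
two-distinct-pairs {n₁} {zero} 2≤n₁*0 with () ← subst (2 ≤_) (ℕₚ.*-zeroʳ n₁) 2≤n₁*0

not-xor-not : ∀ a b → not a xor not b ≡ a xor b
not-xor-not false b = not-involutive b
not-xor-not true  b = refl

module TightProduct {n₁ n₂} {G₁ : Graph (Fin n₁)} {G₂ : Graph (Fin n₂)} {H : Graph (Fin n₁ × Fin n₂)}
                    (tight : IsTightProduct G₁ G₂ H) where
  module C₁ = Covering {H = H} {G = G₁} {φ = proj₁} (proj₁ tight)
  module C₂ = Covering {H = H} {G = G₂} {φ = proj₂} (proj₂ tight)

  degrees-agree : ∀ a b → degree G₁ a ≡ degree G₂ b
  degrees-agree a b = trans (sym (C₁.degree-preserved (a , b))) (C₂.degree-preserved (a , b))

  module _ (bipartite₁ : Bipartite G₁) (bipartite₂ : Bipartite G₂) where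
    private
      c₁ : Fin n₁ → Bool
      c₁ = proj₁ bipartite₁

      c₂ : Fin n₂ → Bool
      c₂ = proj₁ bipartite₂

      colour : Fin n₁ × Fin n₂ → Bool
      colour (a , b) = c₁ a xor c₂ b

      flips₁ : ∀ a b → adj G₁ a b ≢ 0 → c₁ a ≡ not (c₁ b)
      flips₁ a b e = ¬-not (proj₂ bipartite₁ a b e)

      flips₂ : ∀ a b → adj G₂ a b ≢ 0 → c₂ a ≡ not (c₂ b)
      flips₂ a b e = ¬-not (proj₂ bipartite₂ a b e)

      colour-invariant : ∀ {u v} → Reach H u v → colour u ≡ colour v
      colour-invariant here = refl
      colour-invariant {a , b} (step {w = a′ , b′} e r) = begin
        c₁ a xor c₂ b
          ≡⟨ cong₂ _xor_ (flips₁ a a′ (C₁.edge-image pairs-complete _ _ e))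
                         (flips₂ b b′ (C₂.edge-image pairs-complete _ _ e)) ⟩
        not (c₁ a′) xor not (c₂ b′) ≡⟨ not-xor-not (c₁ a′) (c₂ b′) ⟩
        c₁ a′ xor c₂ b′             ≡⟨ colour-invariant r ⟩
        colour _                    ∎
        where open ≡-Reasoning

    bipartite-factors⇒disconnected : 2 ≤ n₁ * n₂ → Disconnected H
    bipartite-factors⇒disconnected 2≤n₁n₂ connected with two-distinct-pairs 2≤n₁n₂
    ... | u , v , u≢v with connected u v
    ...   | here                      = u≢v refl
    ...   | step {w = b , _} uw≢0 _ = not-¬
      (colour-invariant (connected (a , y) (b , y)))
      (trans (cong (_xor c₂ y) (flips₁ a b (C₁.edge-image pairs-complete _ _ uw≢0)))
             (sym (not-distribˡ-xor (c₁ b) (c₂ y))))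
      where
      a = proj₁ u
      y = proj₂ u

proposition2 : ∀ {c ℓ} {n₁ n₂ : ℕ}
    (G₁ : Graph (Fin n₁)) (G₂ : Graph (Fin n₂)) (H : Graph (Fin n₁ × Fin n₂)) →
    1 ≤ n₁ → 1 ≤ n₂ → IsTightProduct G₁ G₂ H →
    ((R : CommutativeRing c ℓ) (μ : CommutativeRing.Carrier R) →
       (IsEigenvalue R G₁ μ ⊎ IsEigenvalue R G₂ μ) → IsEigenvalue R H μ)
    × ((Bipartite G₁ ⊎ Bipartite G₂) → Bipartite H)
    × ((Disconnected G₁ ⊎ Disconnected G₂) → Disconnected H)
    × (2 ≤ n₁ * n₂ → Bipartite G₁ → Bipartite G₂ → Disconnected H)
    × (∃ λ d → Regular G₁ d × Regular G₂ d)
proposition2 {n₁ = n₁} {n₂} G₁ G₂ H 1≤n₁ 1≤n₂ tight =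
    (λ R μ → [ C₁.eigenvalue-pullback R proj₁-onto , C₂.eigenvalue-pullback R proj₂-onto ])
  , [ C₁.bipartite-pullback pairs-complete , C₂.bipartite-pullback pairs-complete ]
  , [ C₁.disconnected-pullback pairs-complete proj₁-onto
    , C₂.disconnected-pullback pairs-complete proj₂-onto ]
  , (λ 2≤n₁n₂ bipartite₁ bipartite₂ → bipartite-factors⇒disconnected bipartite₁ bipartite₂ 2≤n₁n₂)
  , ( degree G₂ b₀
    , (λ a → degrees-agree a b₀)
    , (λ b → trans (sym (degrees-agree a₀ b)) (degrees-agree a₀ b₀)))
  where
  open TightProduct tight

  a₀ : Fin n₁
  a₀ = fromℕ< 1≤n₁

  b₀ : Fin n₂
  b₀ = fromℕ< 1≤n₂

  proj₁-onto : StrictlySurjective _≡_ (proj₁ {A = Fin n₁} {B = λ _ → Fin n₂})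
  proj₁-onto a = (a , b₀) , refl

  proj₂-onto : StrictlySurjective _≡_ (proj₂ {A = Fin n₁} {B = λ _ → Fin n₂})
  proj₂-onto b = (a₀ , b) , refl
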